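{- Let $\Pi = PG(3,4)$ and let $H$ be a hyperbolic (i.e. $+$ type, non-degenerate) quadric in $\Pi$. Let $\mathcal{O}$ be the set of lines of $\Pi$ that are disjoint from $H$ (contain no point of $H$). Then $|\mathcal{O}| = 72$ and $\mathcal{O}$ is a hyperoval of the line Grassmannian $\mathcal{L}$ of $\Pi$; that is, for every point $p$ and plane $P$ of $\Pi$ with $p \in P$, the number of lines of $\mathcal{O}$ that contain $p$ and lie in $P$ is either $0$ or $2$.
   Context: The line Grassmannian $\mathcal{L}$ of $\Pi=PG(3,4)$ (isomorphic to the polar space $Q^+(5,4)$) is the partial linear space whose points are the lines of $\Pi$ and whose lines are the pencils $(p,P)$: for a point $p$ and a plane $P$ of $\Pi$ with $p\in P$, the pencil $(p,P)$ is the set of the $5$ lines of $\Pi$ through $p$ contained in $P$. A hyperoval of a partial linear space is a set of points meeting every line in either $0$ or $2$ points; thus a hyperoval of $\mathcal{L}$ is a set of lines of $\Pi$ meeting every pencil in $0$ or $2$ lines. -}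

module Defs where

open import Data.Nat using (ℕ)
open import Data.Fin using (Fin)
open import Data.Vec using (Vec; []; _∷_; map; zipWith; foldr; replicate; lookup)
open import Data.Product using (Σ; ∃; ∃-syntax; _×_; _,_)
open import Data.Sum using (_⊎_)
open import Relation.Binary.PropositionalEquality using (_≡_; _≢_)
open import Relation.Nullary using (¬_)

-- The field GF(4) = {0, 1, ω, ω²}, with ω² = ω + 1 (characteristic 2).

data F : Set where
  𝟘 𝟙 ω ω² : F

infixl 6 _+F_
infixl 7 _*F_

_+F_ : F → F → F
𝟘  +F y  = y
x  +F 𝟘  = x
𝟙  +F 𝟙  = 𝟘
𝟙  +F ω  = ω²
𝟙  +F ω² = ω
ω  +F 𝟙  = ω²
ω  +F ω  = 𝟘
ω  +F ω² = 𝟙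
ω² +F 𝟙  = ω
ω² +F ω  = 𝟙
ω² +F ω² = 𝟘

_*F_ : F → F → F
𝟘  *F y  = 𝟘
x  *F 𝟘  = 𝟘
𝟙  *F y  = y
x  *F 𝟙  = x
ω  *F ω  = ω²
ω  *F ω² = 𝟙
ω² *F ω  = 𝟙
ω² *F ω² = ω

V : Set
V = Vec F 4

0V : V
0V = replicate 4 𝟘

_+V_ : V → V → V
_+V_ = zipWith _+F_

_·V_ : F → V → V
a ·V x = map (a *F_) x

dot : V → V → F
dot x y = foldr (λ _ → F) _+F_ 𝟘 (zipWith _*F_ x y)

Mat : Set
Mat = Vec V 4

apply : Mat → V → V
apply M x = map (λ r → dot r x) M

Invertible : Mat → Set
Invertible M = Σ Mat λ N → (x : V) → apply N (apply M x) ≡ x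

-- A point is represented by any nonzero vector (its span).
-- A plane is represented by any nonzero dual vector w (the plane w·x = 0).
-- A line is represented by a pair of linearly independent vectors (their span);
-- two representations denote the same line iff they span the same subspace.

InSpan : V → V → V → Set
InSpan x u v = ∃[ a ] ∃[ b ] (x ≡ (a ·V u) +V (b ·V v))

Independent : V → V → Set
Independent u v = (a b : F) → (a ·V u) +V (b ·V v) ≡ 0V → (a ≡ 𝟘) × (b ≡ 𝟘)

record Line : Set where
  constructor line
  field
    u v   : V
    indep : Independent u v
open Line public

SameLine : Line → Line → Set
SameLine ℓ ℓ′ = (InSpan (u ℓ′) (u ℓ) (v ℓ) × InSpan (v ℓ′) (u ℓ) (v ℓ))
              × (InSpan (u ℓ) (u ℓ′) (v ℓ′) × InSpan (v ℓ) (u ℓ′) (v ℓ′))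

OnLine : V → Line → Set
OnLine x ℓ = InSpan x (u ℓ) (v ℓ)

OnPlane : V → V → Set
OnPlane x w = dot w x ≡ 𝟘

LineInPlane : Line → V → Set
LineInPlane ℓ w = OnPlane (u ℓ) w × OnPlane (v ℓ) w

-- Every hyperbolic (non-degenerate, + type) quadric of
-- PG(3,4) is projectively equivalent to the standard one  x₀x₁ + x₂x₃ = 0;
-- so a hyperbolic quadric is  H_M = { ⟨x⟩ : Q₀(M x) = 0 }  for an invertible M.

Q₀ : V → F
Q₀ (x₀ ∷ x₁ ∷ x₂ ∷ x₃ ∷ []) = (x₀ *F x₁) +F (x₂ *F x₃)

OnQuadric : Mat → V → Set
OnQuadric M x = Q₀ (apply M x) ≡ 𝟘

DisjointFromQuadric : Mat → Line → Set
DisjointFromQuadric M ℓ = (x : V) → x ≢ 0V → OnLine x ℓ → ¬ OnQuadric M x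

HasCard : ℕ → (Line → Set) → Set
HasCard n P = Σ (Fin n → Line) λ ls →
    ((i : Fin n) → P (ls i))
  × ((i j : Fin n) → i ≢ j → ¬ SameLine (ls i) (ls j))
  × ((ℓ : Line) → P ℓ → ∃[ i ] SameLine ℓ (ls i))

InPencil : (Line → Set) → V → V → Line → Set
InPencil O p w ℓ = O ℓ × OnLine p ℓ × LineInPlane ℓ w

-- The invertible matrix M induces a collineation of PG(3,4) (M is injective on the finite
-- space V, hence bijective) which carries the quadric H_M onto the standard quadric
-- Q₀ = x₀x₁ + x₂x₃ and preserves incidence of points, lines and planes; so it suffices to
-- treat Q₀, which is a finite computation. Every line has exactly one basis in reduced
-- echelon form, on which the points of the line are read off their pivot coordinates;
-- filtering these bases gives the 72 lines avoiding Q₀, without repetition. That no other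
-- line avoids Q₀ is one check over pairs of distinct normalized points p, q: the span of p
-- and q meets Q₀, or a listed line contains both (and a line is determined by two of its
-- points). The pencil condition is then checked for every normalized flag (p, P).

module Submission where

open import Defs
open import Data.Fin as Fin using (Fin; zero; suc; combine; remQuot; punchOut)
open import Data.Fin.Patterns using (0F; 1F; 2F; 3F)
open import Data.Fin.Properties as Finₚ using (combine-remQuot; remQuot-combine; punchOut-injective; injective⇒≤)
open import Data.List as List using (List; allFin)
open import Data.List.Membership.Propositional using (_∈_; lose; find)
open import Data.List.Membership.Propositional.Properties using (∈-map⁺; ∈-allFin; ∈-lookup; ∈-filter⁺; ∈-filter⁻)
import Data.List.Properties as Listₚ
open import Data.List.Relation.Unary.All as All using (All)
import Data.List.Relation.Unary.All.Properties as Allₚ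
open import Data.List.Relation.Unary.AllPairs as AllPairs using (AllPairs; _∷_; allPairs?)
import Data.List.Relation.Unary.AllPairs.Properties as AllPairsₚ
open import Data.List.Relation.Unary.Any as Any using (Any)
open import Data.List.Relation.Unary.Any.Properties as Anyₚ using (lookup-index)
open import Data.Nat as ℕ using (ℕ; zero; suc; _^_)
open import Data.Nat.Properties using (1+n≰n)
open import Data.Product using (∃; ∃₂; _×_; _,_; proj₁; proj₂)
open import Data.Sum as Sum using (_⊎_; inj₁; inj₂)
open import Data.Vec using (Vec; []; _∷_; map; zipWith; foldr; replicate; lookup)
import Data.Vec.Properties as Vecₚ
open import Function using (_∘_)
open import Function.Bundles using (_↔_; Inverse; mk↔ₛ′)
open import Function.Properties.Inverse using (↔⇒↣)
open import Level using (0ℓ)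
open import Relation.Binary.Bundles using (Setoid)
open import Relation.Binary.Definitions using (DecidableEquality; _Respects_)
open import Relation.Binary.PropositionalEquality using (_≡_; _≢_; refl; sym; trans; cong; cong₂; subst; subst₂; module ≡-Reasoning)
import Relation.Binary.Reasoning.Setoid as SetoidReasoning
open import Relation.Nullary using (¬_; Dec; yes; no; contradiction)
open import Relation.Nullary.Decidable using (map′; via-injection; from-yes; _×-dec_; _⊎-dec_; ¬?; _→-dec_)
open import Relation.Unary using (Decidable; _≐_; _⊆_)

private
  variable
    A : Set
    m n : ℕ

-- Finite types

module _ (A↔Fin : A ↔ Fin n) where
  open Inverse A↔Fin

  enumerate : List A
  enumerate = List.map from (allFin n)

  ∈-enumerate : ∀ x → x ∈ enumerate
  ∈-enumerate x = subst (_∈ enumerate) (strictlyInverseʳ x) (∈-map⁺ from (∈-allFin (to x)))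

  ∀? : {P : A → Set} → Decidable P → Dec (∀ x → P x)
  ∀? P? = map′ (λ all x → All.lookup all (∈-enumerate x)) (λ all → All.tabulate λ {x} _ → all x) (All.all? P? enumerate)

  ∃? : {P : A → Set} → Decidable P → Dec (∃ P)
  ∃? P? = map′ Any.satisfied (λ (x , px) → lose (∈-enumerate x) px) (Any.any? P? enumerate)

module _ (A↔Fin : A ↔ Fin m) where
  open Inverse A↔Fin

  private
    encode : Vec A n → Fin (m ^ n)
    encode [] = zero
    encode (x ∷ xs) = combine (to x) (encode xs)

    decode : ∀ n → Fin (m ^ n) → Vec A n
    decode zero _ = []
    decode (suc n) i = from (proj₁ (remQuot {m} (m ^ n) i)) ∷ decode n (proj₂ (remQuot {m} (m ^ n) i))

    encode-decode : ∀ n i → encode (decode n i) ≡ i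
    encode-decode zero zero = refl
    encode-decode (suc n) i = trans
      (cong₂ combine (strictlyInverseˡ (proj₁ (remQuot {m} (m ^ n) i))) (encode-decode n (proj₂ (remQuot {m} (m ^ n) i))))
      (combine-remQuot {m} (m ^ n) i)

    decode-encode : ∀ {n} (xs : Vec A n) → decode n (encode xs) ≡ xs
    decode-encode [] = refl
    decode-encode {suc n} (x ∷ xs) = cong₂ _∷_
      (trans (cong (from ∘ proj₁) quotient) (strictlyInverseʳ x))
      (trans (cong (decode n ∘ proj₂) quotient) (decode-encode xs))
      where quotient = remQuot-combine {m} {m ^ n} (to x) (encode xs)

  Vec↔Fin : Vec A n ↔ Fin (m ^ n)
  Vec↔Fin {n} = mk↔ₛ′ encode (decode n) (encode-decode n) decode-encode

Fin-injective⇒surjective : ∀ {f : Fin n → Fin n} → (∀ {i j} → f i ≡ f j → i ≡ j) → ∀ j → ∃ λ i → f i ≡ j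
Fin-injective⇒surjective {suc n} {f} f-injective j with Finₚ.any? (λ i → f i Fin.≟ j)
... | yes hit = hit
... | no miss = contradiction (injective⇒≤ punchOut∘f-injective) 1+n≰n
  where
  j≢f : ∀ i → j ≢ f i
  j≢f i j≡fi = miss (i , sym j≡fi)
  punchOut∘f-injective : ∀ {i k} → punchOut (j≢f i) ≡ punchOut (j≢f k) → i ≡ k
  punchOut∘f-injective = f-injective ∘ punchOut-injective (j≢f _) (j≢f _)

injective⇒surjective : A ↔ Fin n → ∀ {f : A → A} → (∀ {x y} → f x ≡ f y → x ≡ y) → ∀ y → ∃ λ x → f x ≡ y
injective⇒surjective A↔Fin {f} f-injective y =
  let i , g[i]≡y = Fin-injective⇒surjective g-injective (to y) in from i , to-injective g[i]≡y
  where
  open Inverse A↔Fin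
  to-injective : ∀ {x y} → to x ≡ to y → x ≡ y
  to-injective {x} {y} eq = trans (sym (strictlyInverseʳ x)) (trans (cong from eq) (strictlyInverseʳ y))
  g-injective : ∀ {i j} → to (f (from i)) ≡ to (f (from j)) → i ≡ j
  g-injective {i} {j} eq = trans (sym (strictlyInverseˡ i)) (trans (cong to (f-injective (to-injective eq))) (strictlyInverseˡ j))

-- Arithmetic in GF(4)

toFin : F → Fin 4
toFin 𝟘 = 0F
toFin 𝟙 = 1F
toFin ω = 2F
toFin ω² = 3F

fromFin : Fin 4 → F
fromFin 0F = 𝟘
fromFin 1F = 𝟙
fromFin 2F = ω
fromFin 3F = ω²

F↔Fin4 : F ↔ Fin 4
F↔Fin4 = mk↔ₛ′ toFin fromFin toFin-fromFin fromFin-toFin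
  where
  toFin-fromFin : ∀ i → toFin (fromFin i) ≡ i
  toFin-fromFin 0F = refl
  toFin-fromFin 1F = refl
  toFin-fromFin 2F = refl
  toFin-fromFin 3F = refl
  fromFin-toFin : ∀ x → fromFin (toFin x) ≡ x
  fromFin-toFin 𝟘 = refl
  fromFin-toFin 𝟙 = refl
  fromFin-toFin ω = refl
  fromFin-toFin ω² = refl

infix 4 _≟F_
_≟F_ : DecidableEquality F
_≟F_ = via-injection (↔⇒↣ F↔Fin4) Fin._≟_

∀F? : {P : F → Set} → Decidable P → Dec (∀ x → P x)
∀F? = ∀? F↔Fin4

∃F? : {P : F → Set} → Decidable P → Dec (∃ P)
∃F? = ∃? F↔Fin4

inv : F → F
inv 𝟘 = 𝟘
inv 𝟙 = 𝟙
inv ω = ω²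
inv ω² = ω

-- Identities checked by evaluation at all arguments; abstract, so that the evaluation
-- happens here once and not wherever Agda unfolds a use of them.
abstract
  *F-comm : ∀ x y → x *F y ≡ y *F x
  *F-comm = from-yes (∀F? λ x → ∀F? λ y → x *F y ≟F y *F x)

  *F-zeroʳ : ∀ x → x *F 𝟘 ≡ 𝟘
  *F-zeroʳ = from-yes (∀F? λ x → x *F 𝟘 ≟F 𝟘)

  *F-identityˡ : ∀ x → 𝟙 *F x ≡ x
  *F-identityˡ = from-yes (∀F? λ x → 𝟙 *F x ≟F x)

  *F-identityʳ : ∀ x → x *F 𝟙 ≡ x
  *F-identityʳ = from-yes (∀F? λ x → x *F 𝟙 ≟F x)

  +F-identityʳ : ∀ x → x +F 𝟘 ≡ x
  +F-identityʳ = from-yes (∀F? λ x → x +F 𝟘 ≟F x)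

  scale-lincombF : ∀ c a x b y → c *F (a *F x +F b *F y) ≡ (c *F a) *F x +F (c *F b) *F y
  scale-lincombF = from-yes (∀F? λ c → ∀F? λ a → ∀F? λ x → ∀F? λ b → ∀F? λ y →
    c *F (a *F x +F b *F y) ≟F (c *F a) *F x +F (c *F b) *F y)

  lincomb-+F : ∀ a b c d x y → (a *F x +F b *F y) +F (c *F x +F d *F y) ≡ (a +F c) *F x +F (b +F d) *F y
  lincomb-+F = from-yes (∀F? λ a → ∀F? λ b → ∀F? λ c → ∀F? λ d → ∀F? λ x → ∀F? λ y →
    (a *F x +F b *F y) +F (c *F x +F d *F y) ≟F (a +F c) *F x +F (b +F d) *F y)

  *F-distrib-lincombF : ∀ r a x b y → r *F (a *F x +F b *F y) ≡ a *F (r *F x) +F b *F (r *F y)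
  *F-distrib-lincombF = from-yes (∀F? λ r → ∀F? λ a → ∀F? λ x → ∀F? λ b → ∀F? λ y →
    r *F (a *F x +F b *F y) ≟F a *F (r *F x) +F b *F (r *F y))

  lincombF-+F : ∀ a b x y z w → (a *F x +F b *F y) +F (a *F z +F b *F w) ≡ a *F (x +F z) +F b *F (y +F w)
  lincombF-+F = from-yes (∀F? λ a → ∀F? λ b → ∀F? λ x → ∀F? λ y → ∀F? λ z → ∀F? λ w →
    (a *F x +F b *F y) +F (a *F z +F b *F w) ≟F a *F (x +F z) +F b *F (y +F w))

  dot-scaleʳF : ∀ c x y z → x *F (c *F y) +F c *F z ≡ c *F (x *F y +F z)
  dot-scaleʳF = from-yes (∀F? λ c → ∀F? λ x → ∀F? λ y → ∀F? λ z → x *F (c *F y) +F c *F z ≟F c *F (x *F y +F z))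

  multiples-dependentF : ∀ a b x → b *F (a *F x) +F a *F (b *F x) ≡ 𝟘
  multiples-dependentF = from-yes (∀F? λ a → ∀F? λ b → ∀F? λ x → b *F (a *F x) +F a *F (b *F x) ≟F 𝟘)

  rows-dependent-or-invertible : ∀ a b c d →
      (∃₂ λ s t → ¬ (s ≡ 𝟘 × t ≡ 𝟘) × s *F a +F t *F c ≡ 𝟘 × s *F b +F t *F d ≡ 𝟘)
    ⊎ ((∃₂ λ s t → s *F a +F t *F c ≡ 𝟙 × s *F b +F t *F d ≡ 𝟘)
     × (∃₂ λ s t → s *F a +F t *F c ≡ 𝟘 × s *F b +F t *F d ≡ 𝟙))
  rows-dependent-or-invertible = from-yes (∀F? λ a → ∀F? λ b → ∀F? λ c → ∀F? λ d →
       (∃F? λ s → ∃F? λ t → ¬? ((s ≟F 𝟘) ×-dec (t ≟F 𝟘)) ×-dec (s *F a +F t *F c ≟F 𝟘) ×-dec (s *F b +F t *F d ≟F 𝟘))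
    ⊎-dec ((∃F? λ s → ∃F? λ t → (s *F a +F t *F c ≟F 𝟙) ×-dec (s *F b +F t *F d ≟F 𝟘))
     ×-dec (∃F? λ s → ∃F? λ t → (s *F a +F t *F c ≟F 𝟘) ×-dec (s *F b +F t *F d ≟F 𝟙))))

-- Vectors and matrices

lincomb : F → Vec F n → F → Vec F n → Vec F n
lincomb a x b y = zipWith _+F_ (map (a *F_) x) (map (b *F_) y)

-- dot for every length: on V, ⟨ x , y ⟩ and dot x y are definitionally equal
⟨_,_⟩ : Vec F n → Vec F n → F
⟨ x , y ⟩ = foldr (λ _ → F) _+F_ 𝟘 (zipWith _*F_ x y)

infix 4 _≟V_
_≟V_ : DecidableEquality (Vec F n)
_≟V_ = Vecₚ.≡-dec _≟F_

scale-lincomb : ∀ c a b (x y : Vec F n) → map (c *F_) (lincomb a x b y) ≡ lincomb (c *F a) x (c *F b) y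
scale-lincomb c a b [] [] = refl
scale-lincomb c a b (x ∷ xs) (y ∷ ys) = cong₂ _∷_ (scale-lincombF c a x b y) (scale-lincomb c a b xs ys)

lincomb-+ : ∀ a b c d (x y : Vec F n) → zipWith _+F_ (lincomb a x b y) (lincomb c x d y) ≡ lincomb (a +F c) x (b +F d) y
lincomb-+ a b c d [] [] = refl
lincomb-+ a b c d (x ∷ xs) (y ∷ ys) = cong₂ _∷_ (lincomb-+F a b c d x y) (lincomb-+ a b c d xs ys)

lincomb-lincomb : ∀ a b a₁ b₁ a₂ b₂ (x y : Vec F n) →
  lincomb a (lincomb a₁ x b₁ y) b (lincomb a₂ x b₂ y) ≡ lincomb (a *F a₁ +F b *F a₂) x (a *F b₁ +F b *F b₂) y
lincomb-lincomb a b a₁ b₁ a₂ b₂ x y = begin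
  lincomb a (lincomb a₁ x b₁ y) b (lincomb a₂ x b₂ y)
    ≡⟨ cong₂ (zipWith _+F_) (scale-lincomb a a₁ b₁ x y) (scale-lincomb b a₂ b₂ x y) ⟩
  zipWith _+F_ (lincomb (a *F a₁) x (a *F b₁) y) (lincomb (b *F a₂) x (b *F b₂) y)
    ≡⟨ lincomb-+ (a *F a₁) (a *F b₁) (b *F a₂) (b *F b₂) x y ⟩
  lincomb (a *F a₁ +F b *F a₂) x (a *F b₁ +F b *F b₂) y ∎
  where open ≡-Reasoning

lincomb-𝟙-𝟘 : ∀ (x y : Vec F n) → lincomb 𝟙 x 𝟘 y ≡ x
lincomb-𝟙-𝟘 [] [] = refl
lincomb-𝟙-𝟘 (x ∷ xs) (y ∷ ys) = cong₂ _∷_ (trans (+F-identityʳ (𝟙 *F x)) (*F-identityˡ x)) (lincomb-𝟙-𝟘 xs ys)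

lincomb-𝟘-𝟙 : ∀ (x y : Vec F n) → lincomb 𝟘 x 𝟙 y ≡ y
lincomb-𝟘-𝟙 [] [] = refl
lincomb-𝟘-𝟙 (x ∷ xs) (y ∷ ys) = cong₂ _∷_ (*F-identityˡ y) (lincomb-𝟘-𝟙 xs ys)

lincomb-𝟘-𝟘 : ∀ (x y : Vec F n) → lincomb 𝟘 x 𝟘 y ≡ replicate n 𝟘
lincomb-𝟘-𝟘 [] [] = refl
lincomb-𝟘-𝟘 (x ∷ xs) (y ∷ ys) = cong (𝟘 ∷_) (lincomb-𝟘-𝟘 xs ys)

multiples-dependent : ∀ a b (x : Vec F n) → lincomb b (map (a *F_) x) a (map (b *F_) x) ≡ replicate n 𝟘
multiples-dependent a b [] = refl
multiples-dependent a b (x ∷ xs) = cong₂ _∷_ (multiples-dependentF a b x) (multiples-dependent a b xs)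

lookup-lincomb : ∀ a b (x y : Vec F n) i → lookup (lincomb a x b y) i ≡ a *F lookup x i +F b *F lookup y i
lookup-lincomb a b x y i = trans (Vecₚ.lookup-zipWith _+F_ i (map (a *F_) x) (map (b *F_) y))
  (cong₂ _+F_ (Vecₚ.lookup-map i (a *F_) x) (Vecₚ.lookup-map i (b *F_) y))

dot-comm : ∀ (x y : Vec F n) → ⟨ x , y ⟩ ≡ ⟨ y , x ⟩
dot-comm [] [] = refl
dot-comm (x ∷ xs) (y ∷ ys) = cong₂ _+F_ (*F-comm x y) (dot-comm xs ys)

dot-zeroʳ : ∀ (x : Vec F n) → ⟨ x , replicate n 𝟘 ⟩ ≡ 𝟘
dot-zeroʳ [] = refl
dot-zeroʳ (x ∷ xs) = cong₂ _+F_ (*F-zeroʳ x) (dot-zeroʳ xs)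

dot-scaleʳ : ∀ c (x y : Vec F n) → ⟨ x , map (c *F_) y ⟩ ≡ c *F ⟨ x , y ⟩
dot-scaleʳ c [] [] = sym (*F-zeroʳ c)
dot-scaleʳ c (x ∷ xs) (y ∷ ys) = trans (cong (x *F (c *F y) +F_) (dot-scaleʳ c xs ys)) (dot-scaleʳF c x y ⟨ xs , ys ⟩)

dot-lincomb : ∀ (r : Vec F n) a x b y → ⟨ r , lincomb a x b y ⟩ ≡ a *F ⟨ r , x ⟩ +F b *F ⟨ r , y ⟩
dot-lincomb [] a [] b [] = sym (cong₂ _+F_ (*F-zeroʳ a) (*F-zeroʳ b))
dot-lincomb (r ∷ rs) a (x ∷ xs) b (y ∷ ys) = begin
  r *F (a *F x +F b *F y) +F ⟨ rs , lincomb a xs b ys ⟩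
    ≡⟨ cong₂ _+F_ (*F-distrib-lincombF r a x b y) (dot-lincomb rs a xs b ys) ⟩
  (a *F (r *F x) +F b *F (r *F y)) +F (a *F ⟨ rs , xs ⟩ +F b *F ⟨ rs , ys ⟩)
    ≡⟨ lincombF-+F a b (r *F x) (r *F y) ⟨ rs , xs ⟩ ⟨ rs , ys ⟩ ⟩
  a *F (r *F x +F ⟨ rs , xs ⟩) +F b *F (r *F y +F ⟨ rs , ys ⟩) ∎
  where open ≡-Reasoning

dot-nondegenerate : ∀ (w : Vec F n) → (∀ y → ⟨ w , y ⟩ ≡ 𝟘) → w ≡ replicate n 𝟘
dot-nondegenerate [] _ = refl
dot-nondegenerate (w ∷ ws) w⊥ = cong₂ _∷_ w≡𝟘 (dot-nondegenerate ws ws⊥)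
  where
  w≡𝟘 : w ≡ 𝟘
  w≡𝟘 = begin
    w                               ≡⟨ *F-identityʳ w ⟨
    w *F 𝟙                          ≡⟨ +F-identityʳ (w *F 𝟙) ⟨
    w *F 𝟙 +F 𝟘                     ≡⟨ cong (w *F 𝟙 +F_) (dot-zeroʳ ws) ⟨
    ⟨ w ∷ ws , 𝟙 ∷ replicate _ 𝟘 ⟩  ≡⟨ w⊥ (𝟙 ∷ replicate _ 𝟘) ⟩
    𝟘                               ∎
    where open ≡-Reasoning
  ws⊥ : ∀ y → ⟨ ws , y ⟩ ≡ 𝟘
  ws⊥ y = trans (cong (_+F ⟨ ws , y ⟩) (sym (*F-zeroʳ w))) (w⊥ (𝟘 ∷ y))

apply-lincomb : ∀ (M : Mat) a x b y → apply M (lincomb a x b y) ≡ lincomb a (apply M x) b (apply M y)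
apply-lincomb M a x b y = go M
  where
  go : (rows : Vec V m) → map (λ r → dot r (lincomb a x b y)) rows ≡ lincomb a (map (λ r → dot r x) rows) b (map (λ r → dot r y) rows)
  go [] = refl
  go (r ∷ rows) = cong₂ _∷_ (dot-lincomb r a x b y) (go rows)

apply-zero : ∀ (M : Mat) → apply M 0V ≡ 0V
apply-zero M = go M
  where
  go : (rows : Vec V m) → map (λ r → dot r 0V) rows ≡ replicate m 𝟘
  go [] = refl
  go (r ∷ rows) = cong₂ _∷_ (dot-zeroʳ r) (go rows)

-- applyᵀ N w is the row vector wᵀN
applyᵀ : Vec (Vec F n) m → Vec F m → Vec F n
applyᵀ [] [] = replicate _ 𝟘
applyᵀ (r ∷ rows) (c ∷ w) = lincomb c r 𝟙 (applyᵀ rows w)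

dot-applyᵀ : ∀ (N : Vec (Vec F n) m) w y → ⟨ applyᵀ N w , y ⟩ ≡ ⟨ w , map (λ r → ⟨ r , y ⟩) N ⟩
dot-applyᵀ [] [] y = trans (dot-comm _ y) (dot-zeroʳ y)
dot-applyᵀ (r ∷ N) (c ∷ w) y = begin
  ⟨ lincomb c r 𝟙 (applyᵀ N w) , y ⟩                ≡⟨ dot-comm _ y ⟩
  ⟨ y , lincomb c r 𝟙 (applyᵀ N w) ⟩                ≡⟨ dot-lincomb y c r 𝟙 (applyᵀ N w) ⟩
  c *F ⟨ y , r ⟩ +F 𝟙 *F ⟨ y , applyᵀ N w ⟩          ≡⟨ cong₂ (λ s t → c *F s +F t) (dot-comm y r) (trans (*F-identityˡ _) (dot-comm y _)) ⟩
  c *F ⟨ r , y ⟩ +F ⟨ applyᵀ N w , y ⟩               ≡⟨ cong (c *F ⟨ r , y ⟩ +F_) (dot-applyᵀ N w y) ⟩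
  c *F ⟨ r , y ⟩ +F ⟨ w , map (λ r → ⟨ r , y ⟩) N ⟩  ∎
  where open ≡-Reasoning

V↔Fin : V ↔ Fin (4 ^ 4)
V↔Fin = Vec↔Fin F↔Fin4

-- Spans, lines and incidence

InSpan-left : ∀ u v → InSpan u u v
InSpan-left u v = 𝟙 , 𝟘 , sym (lincomb-𝟙-𝟘 u v)

InSpan-right : ∀ u v → InSpan v u v
InSpan-right u v = 𝟘 , 𝟙 , sym (lincomb-𝟘-𝟙 u v)

InSpan-trans : ∀ {x u′ v′ u v} → InSpan x u′ v′ → InSpan u′ u v → InSpan v′ u v → InSpan x u v
InSpan-trans {u = u} {v} (a , b , refl) (a₁ , b₁ , refl) (a₂ , b₂ , refl) =
  a *F a₁ +F b *F a₂ , a *F b₁ +F b *F b₂ , lincomb-lincomb a b a₁ b₁ a₂ b₂ u v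

InSpan-scale : ∀ c {x u v} → InSpan x u v → InSpan (c ·V x) u v
InSpan-scale c {u = u} {v} (a , b , refl) = c *F a , c *F b , scale-lincomb c a b u v

Independent⇒≢0ˡ : ∀ {u v} → Independent u v → u ≢ 0V
Independent⇒≢0ˡ {v = v} indep refl with () ← proj₁ (indep 𝟙 𝟘 (lincomb-𝟙-𝟘 0V v))

Independent⇒≢0ʳ : ∀ {u v} → Independent u v → v ≢ 0V
Independent⇒≢0ʳ {u} indep refl with () ← proj₂ (indep 𝟘 𝟙 (lincomb-𝟘-𝟙 u 0V))

Independent-multiples⇒≡𝟘 : ∀ {u v x} a b → Independent u v → u ≡ a ·V x → v ≡ b ·V x → b ≡ 𝟘
Independent-multiples⇒≡𝟘 {x = x} a b indep refl refl = proj₁ (indep b a (multiples-dependent a b x))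

-- The matrix expressing u, v in terms of u′, v′ is singular, against the independence of
-- u and v, or invertible.
span-exchange : ∀ {u v u′ v′} → Independent u v → InSpan u u′ v′ → InSpan v u′ v′ → InSpan u′ u v × InSpan v′ u v
span-exchange {u′ = u′} {v′} indep (a , b , refl) (c , d , refl) with rows-dependent-or-invertible a b c d
... | inj₁ (s , t , nontrivial , e₁ , e₂) = contradiction (indep s t relation) nontrivial
  where
  open ≡-Reasoning
  relation : lincomb s (lincomb a u′ b v′) t (lincomb c u′ d v′) ≡ 0V
  relation = begin
    lincomb s (lincomb a u′ b v′) t (lincomb c u′ d v′) ≡⟨ lincomb-lincomb s t a b c d u′ v′ ⟩
    lincomb (s *F a +F t *F c) u′ (s *F b +F t *F d) v′ ≡⟨ cong₂ (λ α β → lincomb α u′ β v′) e₁ e₂ ⟩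
    lincomb 𝟘 u′ 𝟘 v′                                   ≡⟨ lincomb-𝟘-𝟘 u′ v′ ⟩
    0V                                                  ∎
... | inj₂ ((s₁ , t₁ , e₁ , e₂) , (s₂ , t₂ , e₃ , e₄)) =
  (s₁ , t₁ , sym (trans (recombine s₁ t₁ e₁ e₂) (lincomb-𝟙-𝟘 u′ v′))) ,
  (s₂ , t₂ , sym (trans (recombine s₂ t₂ e₃ e₄) (lincomb-𝟘-𝟙 u′ v′)))
  where
  recombine : ∀ s t {α β} → s *F a +F t *F c ≡ α → s *F b +F t *F d ≡ β →
              lincomb s (lincomb a u′ b v′) t (lincomb c u′ d v′) ≡ lincomb α u′ β v′
  recombine s t e e′ = trans (lincomb-lincomb s t a b c d u′ v′) (cong₂ (λ α β → lincomb α u′ β v′) e e′)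

infix 4 _⊆ₗ_
record _⊆ₗ_ (ℓ ℓ′ : Line) : Set where
  constructor _,_
  field
    u-on : OnLine (u ℓ) ℓ′
    v-on : OnLine (v ℓ) ℓ′

OnLine-⊆ : ∀ {x ℓ ℓ′} → ℓ ⊆ₗ ℓ′ → OnLine x ℓ → OnLine x ℓ′
OnLine-⊆ (uℓ∈ℓ′ , vℓ∈ℓ′) x∈ℓ = InSpan-trans x∈ℓ uℓ∈ℓ′ vℓ∈ℓ′

⊆ₗ-refl : ∀ ℓ → ℓ ⊆ₗ ℓ
⊆ₗ-refl ℓ = InSpan-left (u ℓ) (v ℓ) , InSpan-right (u ℓ) (v ℓ)

⊆ₗ-trans : ∀ {ℓ₁ ℓ₂ ℓ₃} → ℓ₁ ⊆ₗ ℓ₂ → ℓ₂ ⊆ₗ ℓ₃ → ℓ₁ ⊆ₗ ℓ₃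
⊆ₗ-trans (u∈ℓ₂ , v∈ℓ₂) ℓ₂⊆ℓ₃ = OnLine-⊆ ℓ₂⊆ℓ₃ u∈ℓ₂ , OnLine-⊆ ℓ₂⊆ℓ₃ v∈ℓ₂

SameLine⇒⊆ₗ : ∀ {ℓ ℓ′} → SameLine ℓ ℓ′ → ℓ ⊆ₗ ℓ′
SameLine⇒⊆ₗ (_ , (uℓ∈ℓ′ , vℓ∈ℓ′)) = uℓ∈ℓ′ , vℓ∈ℓ′

SameLine⇒⊇ₗ : ∀ {ℓ ℓ′} → SameLine ℓ ℓ′ → ℓ′ ⊆ₗ ℓ
SameLine⇒⊇ₗ ((uℓ′∈ℓ , vℓ′∈ℓ) , _) = uℓ′∈ℓ , vℓ′∈ℓ

⊆ₗ⇒SameLine : ∀ {ℓ ℓ′} → ℓ ⊆ₗ ℓ′ → SameLine ℓ ℓ′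
⊆ₗ⇒SameLine {ℓ} (uℓ∈ℓ′ , vℓ∈ℓ′) = span-exchange (indep ℓ) uℓ∈ℓ′ vℓ∈ℓ′ , (uℓ∈ℓ′ , vℓ∈ℓ′)

SameLine-refl : ∀ ℓ → SameLine ℓ ℓ
SameLine-refl ℓ = ⊆ₗ⇒SameLine (⊆ₗ-refl ℓ)

SameLine-sym : ∀ {ℓ ℓ′} → SameLine ℓ ℓ′ → SameLine ℓ′ ℓ
SameLine-sym (ℓ′⊆ℓ , ℓ⊆ℓ′) = ℓ⊆ℓ′ , ℓ′⊆ℓ

SameLine-trans : ∀ {ℓ₁ ℓ₂ ℓ₃} → SameLine ℓ₁ ℓ₂ → SameLine ℓ₂ ℓ₃ → SameLine ℓ₁ ℓ₃
SameLine-trans {ℓ₁} {ℓ₂} {ℓ₃} ℓ₁≡ℓ₂ ℓ₂≡ℓ₃ =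
  ⊆ₗ⇒SameLine (⊆ₗ-trans (SameLine⇒⊆ₗ {ℓ₁} {ℓ₂} ℓ₁≡ℓ₂) (SameLine⇒⊆ₗ {ℓ₂} {ℓ₃} ℓ₂≡ℓ₃))

SameLine-≡ : ∀ {ℓ ℓ′} → u ℓ ≡ u ℓ′ → v ℓ ≡ v ℓ′ → SameLine ℓ ℓ′
SameLine-≡ {ℓ} {ℓ′} uℓ≡uℓ′ vℓ≡vℓ′ =
  ⊆ₗ⇒SameLine {ℓ} {ℓ′} (within (InSpan-left (u ℓ) (v ℓ)) , within (InSpan-right (u ℓ) (v ℓ)))
  where
  within : ∀ {x} → InSpan x (u ℓ) (v ℓ) → OnLine x ℓ′
  within {x} = subst₂ (InSpan x) uℓ≡uℓ′ vℓ≡vℓ′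

SameLine-setoid : Setoid 0ℓ 0ℓ
SameLine-setoid = record
  { Carrier       = Line
  ; _≈_           = SameLine
  ; isEquivalence = record
    { refl  = λ {ℓ} → SameLine-refl ℓ
    ; sym   = λ {ℓ} {ℓ′} → SameLine-sym {ℓ} {ℓ′}
    ; trans = λ {ℓ₁} {ℓ₂} {ℓ₃} → SameLine-trans {ℓ₁} {ℓ₂} {ℓ₃}
    }
  }

OnPlane-span : ∀ w {x u v} → InSpan x u v → OnPlane u w → OnPlane v w → OnPlane x w
OnPlane-span w {u = u} {v} (a , b , refl) wu≡𝟘 wv≡𝟘 = begin
  dot w (lincomb a u b v)        ≡⟨ dot-lincomb w a u b v ⟩
  a *F dot w u +F b *F dot w v   ≡⟨ cong₂ (λ s t → a *F s +F b *F t) wu≡𝟘 wv≡𝟘 ⟩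
  a *F 𝟘 +F b *F 𝟘               ≡⟨ cong₂ _+F_ (*F-zeroʳ a) (*F-zeroʳ b) ⟩
  𝟘                              ∎
  where open ≡-Reasoning

LineInPlane-⊆ : ∀ w {ℓ ℓ′} → ℓ ⊆ₗ ℓ′ → LineInPlane ℓ′ w → LineInPlane ℓ w
LineInPlane-⊆ w (uℓ∈ℓ′ , vℓ∈ℓ′) (uℓ′∈w , vℓ′∈w) = OnPlane-span w uℓ∈ℓ′ uℓ′∈w vℓ′∈w , OnPlane-span w vℓ∈ℓ′ uℓ′∈w vℓ′∈w

record Proportional (x y : V) : Set where
  constructor _,_
  field
    factor : F
    scaled : y ≡ factor ·V x

OnLine-proportional : ∀ {x y} ℓ → Proportional x y → OnLine x ℓ → OnLine y ℓ
OnLine-proportional ℓ (c , refl) = InSpan-scale c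

OnPlane-proportionalᵖ : ∀ {x y} w → Proportional x y → OnPlane x w → OnPlane y w
OnPlane-proportionalᵖ {x} w (c , refl) wx≡𝟘 = trans (dot-scaleʳ c w x) (trans (cong (c *F_) wx≡𝟘) (*F-zeroʳ c))

OnPlane-proportionalʷ : ∀ x {w w′} → Proportional w w′ → OnPlane x w → OnPlane x w′
OnPlane-proportionalʷ x {w} (c , refl) wx≡𝟘 = begin
  dot (c ·V w) x    ≡⟨ dot-comm (c ·V w) x ⟩
  dot x (c ·V w)    ≡⟨ dot-scaleʳ c x w ⟩
  c *F dot x w      ≡⟨ cong (c *F_) (trans (dot-comm x w) wx≡𝟘) ⟩
  c *F 𝟘            ≡⟨ *F-zeroʳ c ⟩
  𝟘                 ∎
  where open ≡-Reasoning

InPencil-proportional : ∀ {O p p′ w w′} → Proportional p p′ → Proportional w w′ → InPencil O p w ⊆ InPencil O p′ w′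
InPencil-proportional p∼p′ w∼w′ {ℓ} (Oℓ , p∈ℓ , uℓ∈w , vℓ∈w) =
  Oℓ , OnLine-proportional ℓ p∼p′ p∈ℓ , OnPlane-proportionalʷ (u ℓ) w∼w′ uℓ∈w , OnPlane-proportionalʷ (v ℓ) w∼w′ vℓ∈w

SpanAvoids : (V → F) → V → V → Set
SpanAvoids f u v = ∀ x → x ≢ 0V → InSpan x u v → f x ≢ 𝟘

-- DisjointFromQuadric M is Avoids (Q₀ ∘ apply M) by definition
Avoids : (V → F) → Line → Set
Avoids f ℓ = SpanAvoids f (u ℓ) (v ℓ)

spanAvoids? : ∀ f u v → Dec (SpanAvoids f u v)
spanAvoids? f u v = map′ (λ avoids x → avoiding avoids) (λ avoids a b x≢0 → avoids _ x≢0 (a , b , refl))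
  (∀F? λ a → ∀F? λ b → ¬? (lincomb a u b v ≟V 0V) →-dec ¬? (f (lincomb a u b v) ≟F 𝟘))
  where
  avoiding : (∀ a b → lincomb a u b v ≢ 0V → f (lincomb a u b v) ≢ 𝟘) → ∀ {x} → x ≢ 0V → InSpan x u v → f x ≢ 𝟘
  avoiding avoids x≢0 (a , b , refl) = avoids a b x≢0

SpanAvoids-⊆ : ∀ {f u v u′ v′} → InSpan u′ u v → InSpan v′ u v → SpanAvoids f u v → SpanAvoids f u′ v′
SpanAvoids-⊆ u′∈uv v′∈uv avoids x x≢0 x∈u′v′ = avoids x x≢0 (InSpan-trans x∈u′v′ u′∈uv v′∈uv)

Avoids-respects : ∀ f → Avoids f Respects SameLine
Avoids-respects f {ℓ} {ℓ′} ℓ≡ℓ′ = let (uℓ′∈ℓ , vℓ′∈ℓ) = SameLine⇒⊇ₗ {ℓ} {ℓ′} ℓ≡ℓ′ in SpanAvoids-⊆ uℓ′∈ℓ vℓ′∈ℓ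

InPencil-respects : ∀ {O} p w → O Respects SameLine → InPencil O p w Respects SameLine
InPencil-respects p w O-respects {ℓ} {ℓ′} ℓ≡ℓ′ (Oℓ , p∈ℓ , ℓ⊆w) =
  O-respects {ℓ} {ℓ′} ℓ≡ℓ′ Oℓ , OnLine-⊆ (SameLine⇒⊆ₗ {ℓ} {ℓ′} ℓ≡ℓ′) p∈ℓ , LineInPlane-⊆ w (SameLine⇒⊇ₗ {ℓ} {ℓ′} ℓ≡ℓ′) ℓ⊆w

-- Counting lines

AllPairs-lookup : ∀ {R : A → A → Set} → (∀ {x y} → R x y → R y x) →
                  ∀ {xs} → AllPairs R xs → ∀ {i j} → i ≢ j → R (List.lookup xs i) (List.lookup xs j)
AllPairs-lookup R-sym (Rx ∷ Rxs) {zero}  {zero}  0≢0 = contradiction refl 0≢0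
AllPairs-lookup R-sym (Rx ∷ Rxs) {zero}  {suc j} _   = All.lookup Rx (∈-lookup j)
AllPairs-lookup R-sym (Rx ∷ Rxs) {suc i} {zero}  _   = R-sym (All.lookup Rx (∈-lookup i))
AllPairs-lookup R-sym (Rx ∷ Rxs) {suc i} {suc j} i≢j = AllPairs-lookup R-sym Rxs (i≢j ∘ cong suc)

HasCard-fromList : ∀ {P : Line → Set} (ls : List Line) → AllPairs (λ ℓ ℓ′ → ¬ SameLine ℓ ℓ′) ls → All P ls →
                   (∀ ℓ → P ℓ → Any (SameLine ℓ) ls) → HasCard (List.length ls) P
HasCard-fromList ls distinct members complete =
  List.lookup ls ,
  (λ i → All.lookup members (∈-lookup i)) ,
  (λ i j → AllPairs-lookup (λ {ℓ} {ℓ′} ℓ≢ℓ′ ℓ′≡ℓ → ℓ≢ℓ′ (SameLine-sym {ℓ′} {ℓ} ℓ′≡ℓ)) distinct) ,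
  (λ ℓ Pℓ → Any.index (complete ℓ Pℓ) , lookup-index (complete ℓ Pℓ))

HasCard-cong : ∀ {P Q : Line → Set} → P ≐ Q → HasCard n P → HasCard n Q
HasCard-cong (P⊆Q , Q⊆P) (ls , members , distinct , complete) =
  ls , P⊆Q ∘ members , distinct , λ ℓ Qℓ → complete ℓ (Q⊆P Qℓ)

module _ (σ τ : Line → Line)
         (σ-cong : ∀ {ℓ ℓ′} → SameLine ℓ ℓ′ → SameLine (σ ℓ) (σ ℓ′))
         (τ-cong : ∀ {ℓ ℓ′} → SameLine ℓ ℓ′ → SameLine (τ ℓ) (τ ℓ′))
         (σ∘τ : ∀ ℓ → SameLine (σ (τ ℓ)) ℓ)
         (τ∘σ : ∀ ℓ → SameLine (τ (σ ℓ)) ℓ)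
         where

  HasCard-preimage : ∀ {P : Line → Set} → P Respects SameLine → HasCard n P → HasCard n (P ∘ σ)
  HasCard-preimage {P = P} P-respects (ls , members , distinct , complete) =
    τ ∘ ls , members′ , distinct′ , complete′
    where
    open SetoidReasoning SameLine-setoid
    members′ : ∀ i → P (σ (τ (ls i)))
    members′ i = P-respects (SameLine-sym {σ (τ (ls i))} {ls i} (σ∘τ (ls i))) (members i)
    distinct′ : ∀ i j → i ≢ j → ¬ SameLine (τ (ls i)) (τ (ls j))
    distinct′ i j i≢j τi≡τj = distinct i j i≢j (begin
      ls i          ≈⟨ σ∘τ (ls i) ⟨
      σ (τ (ls i))  ≈⟨ σ-cong τi≡τj ⟩
      σ (τ (ls j))  ≈⟨ σ∘τ (ls j) ⟩
      ls j          ∎)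
    complete′ : ∀ ℓ → P (σ ℓ) → ∃ λ i → SameLine ℓ (τ (ls i))
    complete′ ℓ Pσℓ = let i , σℓ≡ls[i] = complete (σ ℓ) Pσℓ in i , (begin
      ℓ             ≈⟨ τ∘σ ℓ ⟨
      τ (σ ℓ)       ≈⟨ τ-cong σℓ≡ls[i] ⟩
      τ (ls i)      ∎)

-- Collineations

module _ (M N : Mat) (N∘M : ∀ x → apply N (apply M x) ≡ x) where

  apply-injective : ∀ {x y} → apply M x ≡ apply M y → x ≡ y
  apply-injective {x} {y} Mx≡My = trans (sym (N∘M x)) (trans (cong (apply N) Mx≡My) (N∘M y))

  apply-≢0 : ∀ {x} → x ≢ 0V → apply M x ≢ 0V
  apply-≢0 x≢0 Mx≡0 = x≢0 (apply-injective (trans Mx≡0 (sym (apply-zero M))))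

  apply-independent : ∀ {u v} → Independent u v → Independent (apply M u) (apply M v)
  apply-independent {u} {v} indep a b comb≡0 =
    indep a b (apply-injective (trans (apply-lincomb M a u b v) (trans comb≡0 (sym (apply-zero M)))))

  mapLine : Line → Line
  mapLine ℓ = line (apply M (u ℓ)) (apply M (v ℓ)) (apply-independent (indep ℓ))

  OnLine-mapLine : ∀ {x} ℓ → OnLine x ℓ → OnLine (apply M x) (mapLine ℓ)
  OnLine-mapLine ℓ (a , b , refl) = a , b , apply-lincomb M a (u ℓ) b (v ℓ)

  OnLine-mapLine⁻ : ∀ {x} ℓ → OnLine (apply M x) (mapLine ℓ) → OnLine x ℓ
  OnLine-mapLine⁻ ℓ (a , b , Mx≡) = a , b , apply-injective (trans Mx≡ (sym (apply-lincomb M a (u ℓ) b (v ℓ))))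

  mapLine-cong : ∀ {ℓ ℓ′} → SameLine ℓ ℓ′ → SameLine (mapLine ℓ) (mapLine ℓ′)
  mapLine-cong {ℓ} {ℓ′} ℓ≡ℓ′ =
    let (uℓ∈ℓ′ , vℓ∈ℓ′) = SameLine⇒⊆ₗ {ℓ} {ℓ′} ℓ≡ℓ′ in
    ⊆ₗ⇒SameLine {mapLine ℓ} {mapLine ℓ′} (OnLine-mapLine ℓ′ uℓ∈ℓ′ , OnLine-mapLine ℓ′ vℓ∈ℓ′)

  Avoids-mapLine : ∀ f ℓ → Avoids (f ∘ apply M) ℓ → Avoids f (mapLine ℓ)
  Avoids-mapLine f ℓ avoids y y≢0 (a , b , refl) fy≡𝟘 =
    avoids x x≢0 (a , b , refl) (trans (cong f (apply-lincomb M a (u ℓ) b (v ℓ))) fy≡𝟘)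
    where
    x = lincomb a (u ℓ) b (v ℓ)
    x≢0 : x ≢ 0V
    x≢0 x≡0 = y≢0 (trans (sym (apply-lincomb M a (u ℓ) b (v ℓ))) (trans (cong (apply M) x≡0) (apply-zero M)))

  Avoids-mapLine⁻ : ∀ f ℓ → Avoids f (mapLine ℓ) → Avoids (f ∘ apply M) ℓ
  Avoids-mapLine⁻ f ℓ avoids x x≢0 x∈ℓ = avoids (apply M x) (apply-≢0 x≢0) (OnLine-mapLine ℓ x∈ℓ)

  dot-applyᵀ-apply : ∀ w x → dot (applyᵀ N w) (apply M x) ≡ dot w x
  dot-applyᵀ-apply w x = trans (dot-applyᵀ N w (apply M x)) (cong (dot w) (N∘M x))

  applyᵀ-≢0 : ∀ {w} → w ≢ 0V → applyᵀ N w ≢ 0V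
  applyᵀ-≢0 {w} w≢0 Nᵀw≡0 = w≢0 (dot-nondegenerate w λ x → begin
    dot w x                       ≡⟨ dot-applyᵀ-apply w x ⟨
    dot (applyᵀ N w) (apply M x)  ≡⟨ cong (λ z → dot z (apply M x)) Nᵀw≡0 ⟩
    dot 0V (apply M x)            ≡⟨ dot-comm 0V (apply M x) ⟩
    dot (apply M x) 0V            ≡⟨ dot-zeroʳ (apply M x) ⟩
    𝟘                             ∎)
    where open ≡-Reasoning

  OnPlane-apply : ∀ {x w} → OnPlane x w → OnPlane (apply M x) (applyᵀ N w)
  OnPlane-apply {x} {w} = trans (dot-applyᵀ-apply w x)

  OnPlane-apply⁻ : ∀ {x w} → OnPlane (apply M x) (applyᵀ N w) → OnPlane x w
  OnPlane-apply⁻ {x} {w} = trans (sym (dot-applyᵀ-apply w x))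

  InPencil-mapLine : ∀ {f p w} ℓ → InPencil (Avoids (f ∘ apply M)) p w ℓ →
                     InPencil (Avoids f) (apply M p) (applyᵀ N w) (mapLine ℓ)
  InPencil-mapLine {f} ℓ (avoids , p∈ℓ , uℓ∈w , vℓ∈w) =
    Avoids-mapLine f ℓ avoids , OnLine-mapLine ℓ p∈ℓ , OnPlane-apply uℓ∈w , OnPlane-apply vℓ∈w

  InPencil-mapLine⁻ : ∀ {f p w} ℓ → InPencil (Avoids f) (apply M p) (applyᵀ N w) (mapLine ℓ) →
                      InPencil (Avoids (f ∘ apply M)) p w ℓ
  InPencil-mapLine⁻ {f} ℓ (avoids , p∈ℓ , uℓ∈w , vℓ∈w) =
    Avoids-mapLine⁻ f ℓ avoids , OnLine-mapLine⁻ ℓ p∈ℓ , OnPlane-apply⁻ uℓ∈w , OnPlane-apply⁻ vℓ∈w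

right-inverse : ∀ (M N : Mat) → (∀ x → apply N (apply M x) ≡ x) → ∀ y → apply M (apply N y) ≡ y
right-inverse M N N∘M y = let x , Mx≡y = injective⇒surjective V↔Fin (apply-injective M N N∘M) y in begin
  apply M (apply N y)            ≡⟨ cong (apply M ∘ apply N) Mx≡y ⟨
  apply M (apply N (apply M x))  ≡⟨ cong (apply M) (N∘M x) ⟩
  apply M x                      ≡⟨ Mx≡y ⟩
  y                              ∎
  where open ≡-Reasoning

-- SameLine unfolds to spans, from which Agda cannot infer the lines: hence the lines passed
-- explicitly below.
module _ (M N : Mat) (N∘M : ∀ x → apply N (apply M x) ≡ x) where
  private
    M∘N = right-inverse M N N∘M
    σ = mapLine M N N∘M
    τ = mapLine N M M∘N

  HasCard-mapLine : ∀ {P} → P Respects SameLine → HasCard n P → HasCard n (P ∘ σ)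
  HasCard-mapLine = HasCard-preimage σ τ
    (λ {ℓ} {ℓ′} → mapLine-cong M N N∘M {ℓ} {ℓ′}) (λ {ℓ} {ℓ′} → mapLine-cong N M M∘N {ℓ} {ℓ′})
    (λ ℓ → SameLine-≡ {σ (τ ℓ)} {ℓ} (M∘N (u ℓ)) (M∘N (v ℓ)))
    (λ ℓ → SameLine-≡ {τ (σ ℓ)} {ℓ} (N∘M (u ℓ)) (N∘M (v ℓ)))

  Avoids-transport : ∀ f → HasCard n (Avoids f) → HasCard n (Avoids (f ∘ apply M))
  Avoids-transport f =
    HasCard-cong ((λ {ℓ} → Avoids-mapLine⁻ M N N∘M f ℓ) , (λ {ℓ} → Avoids-mapLine M N N∘M f ℓ)) ∘
    HasCard-mapLine (λ {ℓ} {ℓ′} → Avoids-respects f {ℓ} {ℓ′})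

  InPencil-transport : ∀ f p w → HasCard n (InPencil (Avoids f) (apply M p) (applyᵀ N w)) →
                       HasCard n (InPencil (Avoids (f ∘ apply M)) p w)
  InPencil-transport f p w =
    HasCard-cong ((λ {ℓ} → InPencil-mapLine⁻ M N N∘M ℓ) , (λ {ℓ} → InPencil-mapLine M N N∘M ℓ)) ∘
    HasCard-mapLine (λ {ℓ} {ℓ′} → InPencil-respects (apply M p) (applyᵀ N w) (λ {ℓ} {ℓ′} → Avoids-respects f {ℓ} {ℓ′}) {ℓ} {ℓ′})

-- The standard quadric Q₀

-- the first nonzero coordinate (the last one for the zero vector)
pivot : Vec F (suc n) → Fin (suc n)
pivot (x ∷ []) = zero
pivot (𝟘 ∷ y ∷ ys) = suc (pivot (y ∷ ys))
pivot (x ∷ y ∷ ys) = zero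

leading : Vec F (suc n) → F
leading x = lookup x (pivot x)

normalize : V → V
normalize x = inv (leading x) ·V x

points : List V
points = List.filter (λ x → leading x ≟F 𝟙) (enumerate V↔Fin)

abstract
  normalize-spec : ∀ x → x ≢ 0V → leading x ≢ 𝟘 × x ≡ leading x ·V normalize x × leading (normalize x) ≡ 𝟙
  normalize-spec = from-yes (∀? V↔Fin λ x → ¬? (x ≟V 0V) →-dec
    (¬? (leading x ≟F 𝟘) ×-dec (x ≟V leading x ·V normalize x) ×-dec (leading (normalize x) ≟F 𝟙)))

normalize-∈points : ∀ {x} → x ≢ 0V → normalize x ∈ points
normalize-∈points {x} x≢0 =
  ∈-filter⁺ (λ x → leading x ≟F 𝟙) (∈-enumerate V↔Fin (normalize x)) (proj₂ (proj₂ (normalize-spec x x≢0)))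

normalize-proportional : ∀ {x} → x ≢ 0V → Proportional x (normalize x) × Proportional (normalize x) x
normalize-proportional {x} x≢0 = (inv (leading x) , refl) , (leading x , proj₁ (proj₂ (normalize-spec x x≢0)))

record UnitOn (i j : Fin n) (u v : Vec F n) : Set where
  constructor unitOn
  field
    uᵢ≡𝟙 : lookup u i ≡ 𝟙
    vᵢ≡𝟘 : lookup v i ≡ 𝟘
    uⱼ≡𝟘 : lookup u j ≡ 𝟘
    vⱼ≡𝟙 : lookup v j ≡ 𝟙

unitOn? : ∀ (i j : Fin n) u v → Dec (UnitOn i j u v)
unitOn? i j u v = map′ (λ (a , b , c , d) → unitOn a b c d) (λ (unitOn a b c d) → a , b , c , d)
  ((lookup u i ≟F 𝟙) ×-dec (lookup v i ≟F 𝟘) ×-dec (lookup u j ≟F 𝟘) ×-dec (lookup v j ≟F 𝟙))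

lookup-lincomb-UnitOn : ∀ {i j} {u v : Vec F n} → UnitOn i j u v → ∀ a b →
  lookup (lincomb a u b v) i ≡ a × lookup (lincomb a u b v) j ≡ b
lookup-lincomb-UnitOn {i = i} {j} {u} {v} (unitOn uᵢ≡𝟙 vᵢ≡𝟘 uⱼ≡𝟘 vⱼ≡𝟙) a b =
  (begin
    lookup (lincomb a u b v) i          ≡⟨ lookup-lincomb a b u v i ⟩
    a *F lookup u i +F b *F lookup v i  ≡⟨ cong₂ (λ s t → a *F s +F b *F t) uᵢ≡𝟙 vᵢ≡𝟘 ⟩
    a *F 𝟙 +F b *F 𝟘                    ≡⟨ cong₂ _+F_ (*F-identityʳ a) (*F-zeroʳ b) ⟩
    a +F 𝟘                              ≡⟨ +F-identityʳ a ⟩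
    a                                   ∎) ,
  (begin
    lookup (lincomb a u b v) j          ≡⟨ lookup-lincomb a b u v j ⟩
    a *F lookup u j +F b *F lookup v j  ≡⟨ cong₂ (λ s t → a *F s +F b *F t) uⱼ≡𝟘 vⱼ≡𝟙 ⟩
    a *F 𝟘 +F b *F 𝟙                    ≡⟨ cong₂ _+F_ (*F-zeroʳ a) (*F-identityʳ b) ⟩
    b                                   ∎)
  where open ≡-Reasoning

UnitOn-independent : ∀ {i j u v} → UnitOn i j u v → Independent u v
UnitOn-independent {i} {j} {u} {v} unit a b comb≡0 =
  trans (sym (proj₁ coords)) (trans (cong (λ x → lookup x i) comb≡0) (Vecₚ.lookup-replicate i 𝟘)) ,
  trans (sym (proj₂ coords)) (trans (cong (λ x → lookup x j) comb≡0) (Vecₚ.lookup-replicate j 𝟘))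
  where coords = lookup-lincomb-UnitOn unit a b

UnitOn-InSpan : ∀ {i j u v x} → UnitOn i j u v → InSpan x u v → x ≡ lincomb (lookup x i) u (lookup x j) v
UnitOn-InSpan {u = u} {v} unit (a , b , refl) =
  sym (cong₂ (λ s t → lincomb s u t v) (proj₁ coords) (proj₂ coords))
  where coords = lookup-lincomb-UnitOn unit a b

select : {P : A → Set} → Decidable P → List A → List (∃ P)
select P? List.[] = List.[]
select P? (x List.∷ xs) with P? x
... | yes px = (x , px) List.∷ select P? xs
... | no _ = select P? xs

IsEchelon : V × V → Set
IsEchelon (u , v) = pivot u Fin.< pivot v × UnitOn (pivot u) (pivot v) u v

isEchelon? : Decidable IsEchelon
isEchelon? (u , v) = (pivot u Fin.<? pivot v) ×-dec unitOn? (pivot u) (pivot v) u v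

Echelon : Set
Echelon = ∃ IsEchelon

toLine : Echelon → Line
toLine ((u , v) , _ , unit) = line u v (UnitOn-independent unit)

infix 4 _∈ₑ_ _∈ₑ?_
_∈ₑ_ : V → Echelon → Set
x ∈ₑ ((u , v) , _) = x ≡ lincomb (lookup x (pivot u)) u (lookup x (pivot v)) v

_∈ₑ?_ : ∀ x e → Dec (x ∈ₑ e)
x ∈ₑ? ((u , v) , _) = x ≟V lincomb (lookup x (pivot u)) u (lookup x (pivot v)) v

∈ₑ⇒OnLine : ∀ {x} e → x ∈ₑ e → OnLine x (toLine e)
∈ₑ⇒OnLine {x} ((u , v) , _) x≡ = lookup x (pivot u) , lookup x (pivot v) , x≡

OnLine⇒∈ₑ : ∀ {x} e → OnLine x (toLine e) → x ∈ₑ e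
OnLine⇒∈ₑ (_ , _ , unit) = UnitOn-InSpan unit

echelonBases : List Echelon
echelonBases = select isEchelon? (List.cartesianProduct points points)

linesThrough : V → List Echelon → List Echelon
linesThrough p = List.filter (p ∈ₑ?_)

Differ : Echelon → Echelon → Set
Differ e f = ¬ (u (toLine f) ∈ₑ e × v (toLine f) ∈ₑ e)

differ? : ∀ es → Dec (AllPairs Differ es)
differ? = allPairs? (λ e f → ¬? ((u (toLine f) ∈ₑ? e) ×-dec (v (toLine f) ∈ₑ? e)))

PairsCoveredAt : List V → V → List Echelon → Set
PairsCoveredAt qs p es = All (λ q → p ≡ q ⊎ ¬ SpanAvoids Q₀ p q ⊎ Any (q ∈ₑ_) es) qs

pairsCoveredAt? : ∀ qs p es → Dec (PairsCoveredAt qs p es)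
pairsCoveredAt? qs p es = All.all? (λ q → (p ≟V q) ⊎-dec ¬? (spanAvoids? Q₀ p q) ⊎-dec Any.any? (q ∈ₑ?_) es) qs

inPlane? : ∀ w e → Dec (LineInPlane (toLine e) w)
inPlane? w e = (dot w (u (toLine e)) ≟F 𝟘) ×-dec (dot w (v (toLine e)) ≟F 𝟘)

ZeroOrTwo : ℕ → Set
ZeroOrTwo k = k ≡ 0 ⊎ k ≡ 2

PencilSizesAt : List V → V → List Echelon → Set
PencilSizesAt ws p es = All (λ w → dot w p ≢ 𝟘 ⊎ ZeroOrTwo (List.length (List.filter (inPlane? w) es))) ws

pencilSizesAt? : ∀ ws p es → Dec (PencilSizesAt ws p es)
pencilSizesAt? ws p es = All.all? (λ w → ¬? (dot w p ≟F 𝟘) ⊎-dec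
  (List.length (List.filter (inPlane? w) es) ℕ.≟ 0) ⊎-dec (List.length (List.filter (inPlane? w) es) ℕ.≟ 2)) ws

-- The lists are arguments, not the constants points and externalLines, so that evaluating
-- these decisions computes them once.
pairsCovered? : ∀ ps es → Dec (All (λ p → PairsCoveredAt ps p (linesThrough p es)) ps)
pairsCovered? ps es = All.all? (λ p → pairsCoveredAt? ps p (linesThrough p es)) ps

pencilSizes? : ∀ ps es → Dec (All (λ p → PencilSizesAt ps p (linesThrough p es)) ps)
pencilSizes? ps es = All.all? (λ p → pencilSizesAt? ps p (linesThrough p es)) ps

-- abstract also keeps externalLines from being unfolded, and recomputed, during unification
abstract
  externalLines : List Echelon
  externalLines = List.filter (λ e → spanAvoids? Q₀ (u (toLine e)) (v (toLine e))) echelonBases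

  externalLines-avoid : All (Avoids Q₀ ∘ toLine) externalLines
  externalLines-avoid = Allₚ.all-filter (λ e → spanAvoids? Q₀ (u (toLine e)) (v (toLine e))) echelonBases

  externalLines-length : List.length externalLines ≡ 72
  externalLines-length = from-yes (List.length externalLines ℕ.≟ 72)

  externalLines-differ : AllPairs Differ externalLines
  externalLines-differ = from-yes (differ? externalLines)

  externalLines-pairs : All (λ p → PairsCoveredAt points p (linesThrough p externalLines)) points
  externalLines-pairs = from-yes (pairsCovered? points externalLines)

  externalLines-pencils : All (λ p → PencilSizesAt points p (linesThrough p externalLines)) points
  externalLines-pencils = from-yes (pencilSizes? points externalLines)

Differ⇒¬SameLine : ∀ e f → Differ e f → ¬ SameLine (toLine e) (toLine f)
Differ⇒¬SameLine e f differ e≡f = let (u-on , v-on) = SameLine⇒⊇ₗ {toLine e} {toLine f} e≡f in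
  differ (OnLine⇒∈ₑ e u-on , OnLine⇒∈ₑ e v-on)

externalLines-distinct : AllPairs (λ e f → ¬ SameLine (toLine e) (toLine f)) externalLines
externalLines-distinct = AllPairs.map (λ {e} {f} → Differ⇒¬SameLine e f) externalLines-differ

externalLines-cover : ∀ ℓ → Avoids Q₀ ℓ → ∃ λ e → e ∈ externalLines × SameLine ℓ (toLine e)
externalLines-cover ℓ avoids =
  classify (All.lookup (All.lookup externalLines-pairs (normalize-∈points u≢0)) (normalize-∈points v≢0))
  where
  u≢0 = Independent⇒≢0ˡ (indep ℓ)
  v≢0 = Independent⇒≢0ʳ (indep ℓ)
  p = normalize (u ℓ)
  q = normalize (v ℓ)
  u≡ : u ℓ ≡ leading (u ℓ) ·V p
  u≡ = proj₁ (proj₂ (normalize-spec (u ℓ) u≢0))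
  v≡ : v ℓ ≡ leading (v ℓ) ·V q
  v≡ = proj₁ (proj₂ (normalize-spec (v ℓ) v≢0))
  p≢q : p ≢ q
  p≢q p≡q = proj₁ (normalize-spec (v ℓ) v≢0)
    (Independent-multiples⇒≡𝟘 (leading (u ℓ)) (leading (v ℓ)) (indep ℓ) u≡ (trans v≡ (cong (leading (v ℓ) ·V_) (sym p≡q))))
  p-on : OnLine p ℓ
  p-on = InSpan-scale (inv (leading (u ℓ))) (InSpan-left (u ℓ) (v ℓ))
  q-on : OnLine q ℓ
  q-on = InSpan-scale (inv (leading (v ℓ))) (InSpan-right (u ℓ) (v ℓ))
  classify : p ≡ q ⊎ ¬ SpanAvoids Q₀ p q ⊎ Any (q ∈ₑ_) (linesThrough p externalLines) →
             ∃ λ e → e ∈ externalLines × SameLine ℓ (toLine e)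
  classify (inj₁ p≡q) = contradiction p≡q p≢q
  classify (inj₂ (inj₁ meets)) = contradiction (SpanAvoids-⊆ p-on q-on avoids) meets
  classify (inj₂ (inj₂ hit)) =
    let e , e∈ , q∈e = find hit
        e∈external , p∈e = ∈-filter⁻ (p ∈ₑ?_) e∈
    in e , e∈external , ⊆ₗ⇒SameLine {ℓ} {toLine e}
         (OnLine-proportional (toLine e) (leading (u ℓ) , u≡) (∈ₑ⇒OnLine e p∈e) ,
          OnLine-proportional (toLine e) (leading (v ℓ) , v≡) (∈ₑ⇒OnLine e q∈e))

Avoids-Q₀-card : HasCard 72 (Avoids Q₀)
Avoids-Q₀-card = subst (λ k → HasCard k (Avoids Q₀)) (trans (Listₚ.length-map toLine externalLines) externalLines-length)
  (HasCard-fromList (List.map toLine externalLines)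
    (AllPairsₚ.map⁺ externalLines-distinct) (Allₚ.map⁺ externalLines-avoid)
    (λ ℓ avoids → let e , e∈ , ℓ≡e = externalLines-cover ℓ avoids in Anyₚ.map⁺ (lose e∈ ℓ≡e)))

pencilLines : V → V → List Echelon
pencilLines p w = List.filter (inPlane? w) (linesThrough p externalLines)

∈-pencilLines⁻ : ∀ {e} p w → e ∈ pencilLines p w → e ∈ externalLines × p ∈ₑ e × LineInPlane (toLine e) w
∈-pencilLines⁻ p w e∈ =
  let e∈through , e⊆w = ∈-filter⁻ (inPlane? w) e∈
      e∈external , p∈e = ∈-filter⁻ (p ∈ₑ?_) e∈through
  in e∈external , p∈e , e⊆w

∈-pencilLines⁺ : ∀ {e} p w → e ∈ externalLines → p ∈ₑ e → LineInPlane (toLine e) w → e ∈ pencilLines p w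
∈-pencilLines⁺ p w e∈ p∈e e⊆w = ∈-filter⁺ (inPlane? w) (∈-filter⁺ (p ∈ₑ?_) e∈ p∈e) e⊆w

Avoids-Q₀-pencil-normalized : ∀ {p w} → p ∈ points → w ∈ points → OnPlane p w →
  HasCard 0 (InPencil (Avoids Q₀) p w) ⊎ HasCard 2 (InPencil (Avoids Q₀) p w)
Avoids-Q₀-pencil-normalized {p} {w} p∈ w∈ p∈w with All.lookup (All.lookup externalLines-pencils p∈) w∈
... | inj₁ p∉w = contradiction p∈w p∉w
... | inj₂ size = Sum.map resize resize size
  where
  P = InPencil (Avoids Q₀) p w
  members : ∀ {e} → e ∈ pencilLines p w → P (toLine e)
  members {e} e∈ = let e∈external , p∈e , e⊆w = ∈-pencilLines⁻ p w e∈ in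
    All.lookup externalLines-avoid e∈external , ∈ₑ⇒OnLine e p∈e , e⊆w
  complete : ∀ ℓ → P ℓ → Any (SameLine ℓ) (List.map toLine (pencilLines p w))
  complete ℓ (avoids , p∈ℓ , ℓ⊆w) =
    let e , e∈ , ℓ≡e = externalLines-cover ℓ avoids
        p∈e = OnLine⇒∈ₑ e (OnLine-⊆ (SameLine⇒⊆ₗ {ℓ} {toLine e} ℓ≡e) p∈ℓ)
        e⊆w = LineInPlane-⊆ w (SameLine⇒⊇ₗ {ℓ} {toLine e} ℓ≡e) ℓ⊆w
    in Anyₚ.map⁺ (lose (∈-pencilLines⁺ p w e∈ p∈e e⊆w) ℓ≡e)
  card : HasCard (List.length (List.map toLine (pencilLines p w))) P
  card = HasCard-fromList (List.map toLine (pencilLines p w))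
    (AllPairsₚ.map⁺ (AllPairsₚ.filter⁺ (inPlane? w) (AllPairsₚ.filter⁺ (p ∈ₑ?_) externalLines-distinct)))
    (Allₚ.map⁺ (All.tabulate members)) complete
  resize : ∀ {k} → List.length (pencilLines p w) ≡ k → HasCard k P
  resize eq = subst (λ k → HasCard k P) (trans (Listₚ.length-map toLine (pencilLines p w)) eq) card

Avoids-Q₀-pencil : ∀ p w → p ≢ 0V → w ≢ 0V → OnPlane p w →
  HasCard 0 (InPencil (Avoids Q₀) p w) ⊎ HasCard 2 (InPencil (Avoids Q₀) p w)
Avoids-Q₀-pencil p w p≢0 w≢0 p∈w =
  Sum.map (HasCard-cong same) (HasCard-cong same)
    (Avoids-Q₀-pencil-normalized (normalize-∈points p≢0) (normalize-∈points w≢0) p̂∈ŵ)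
  where
  p∼p̂ = proj₁ (normalize-proportional p≢0)
  p̂∼p = proj₂ (normalize-proportional p≢0)
  w∼ŵ = proj₁ (normalize-proportional w≢0)
  ŵ∼w = proj₂ (normalize-proportional w≢0)
  same : InPencil (Avoids Q₀) (normalize p) (normalize w) ≐ InPencil (Avoids Q₀) p w
  same = (λ {ℓ} → InPencil-proportional {Avoids Q₀} p̂∼p ŵ∼w {ℓ}) , (λ {ℓ} → InPencil-proportional {Avoids Q₀} p∼p̂ w∼ŵ {ℓ})
  p̂∈ŵ : OnPlane (normalize p) (normalize w)
  p̂∈ŵ = OnPlane-proportionalʷ (normalize p) w∼ŵ (OnPlane-proportionalᵖ w p∼p̂ p∈w)

proposition1 : (M : Mat) → Invertible M →
    HasCard 72 (DisjointFromQuadric M)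
    × ((p w : V) → p ≢ 0V → w ≢ 0V → OnPlane p w →
         HasCard 0 (InPencil (DisjointFromQuadric M) p w)
         ⊎ HasCard 2 (InPencil (DisjointFromQuadric M) p w))
proposition1 M (N , N∘M) =
  Avoids-transport M N N∘M Q₀ Avoids-Q₀-card ,
  λ p w p≢0 w≢0 p∈w → Sum.map (InPencil-transport M N N∘M Q₀ p w) (InPencil-transport M N N∘M Q₀ p w)
    (Avoids-Q₀-pencil (apply M p) (applyᵀ N w) (apply-≢0 M N N∘M p≢0) (applyᵀ-≢0 M N N∘M w≢0) (OnPlane-apply M N N∘M p∈w))
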